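{- Let $n=p_1p_2\cdots p_m$ where $m\ge 2$ and $p_1<p_2<\dots<p_m$ are primes. Let $G_2$ be the induced subgraph of the comaximal graph $\Gamma(\mathbb{Z}_n)$ on the set of nonzero non-units of $\mathbb{Z}_n$. Then the vertex connectivity of $G_2$ satisfies $\kappa(G_2)\le\phi(p_1p_2\cdots p_{m-1})$.
   Context: The comaximal graph $\Gamma(\mathbb{Z}_n)$ has vertex set $\mathbb{Z}_n=\{0,1,\dots,n-1\}$, distinct $x,y$ adjacent iff $\langle x\rangle+\langle y\rangle=\mathbb{Z}_n$. The non-units are the $a$ with $\gcd(a,n)\neq 1$. A separating set of a connected graph $G$ is a set $S\subset V(G)$ such that $G-S$ has more than one connected component; $\kappa(G)$ is the minimum size of a separating set. $\phi$ is Euler's totient function. -}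

module Defs where

open import Data.Nat using (ℕ; zero; suc; _+_; _*_; _<_; _≤_)
open import Data.Nat.GCD using (gcd)
open import Data.Nat.DivMod using (_%_)
open import Data.List using (List; []; _∷_; length)
open import Data.List.Membership.Propositional using (_∈_)
open import Relation.Binary.PropositionalEquality using (_≡_)
open import Relation.Nullary using (¬_)
open import Data.Product using (Σ; _×_; ∃-syntax)
import Data.List.Relation.Unary.Unique.Propositional
import Data.Nat
import Relation.Nullary

prod : ℕ → (ℕ → ℕ) → ℕ
prod zero    f = 1
prod (suc m) f = prod m f * f m

-- Euler's totient: number of i with 1 ≤ i ≤ k and gcd(i,k) = 1
-- (so φ 1 = 1, φ 0 = 0)
countCoprime : ℕ → ℕ → ℕ
countCoprime k zero = 0
countCoprime k (suc i) with gcd (suc i) k Data.Nat.≟ 1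
... | Relation.Nullary.yes _ = suc (countCoprime k i)
... | Relation.Nullary.no  _ = countCoprime k i

φ : ℕ → ℕ
φ k = countCoprime k k

-- Vertices of G₂: nonzero non-units of ℤₙ, represented by 0 ≤ x < n
IsG₂Vertex : ℕ → ℕ → Set
IsG₂Vertex n x = (x < n) × ¬ (x ≡ 0) × ¬ (gcd x n ≡ 1)

-- Comaximal: ⟨x⟩ + ⟨y⟩ = ℤₙ, i.e. 1 ∈ ⟨x⟩ + ⟨y⟩ : a x + b y ≡ 1 (mod n)
Comaximal : (n : ℕ) → .{{_ : Data.Nat.NonZero n}} → ℕ → ℕ → Set
Comaximal n x y = ∃[ a ] ∃[ b ] ((a * x + b * y) % n ≡ 1 % n)

Adj : (n : ℕ) → .{{_ : Data.Nat.NonZero n}} → ℕ → ℕ → Set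
Adj n x y = ¬ (x ≡ y) × Comaximal n x y

IsVertexMinus : ℕ → List ℕ → ℕ → Set
IsVertexMinus n S x = IsG₂Vertex n x × ¬ (x ∈ S)

data Walk (n : ℕ) .{{_ : Data.Nat.NonZero n}} (S : List ℕ) : ℕ → ℕ → Set where
  stay : ∀ {x} → IsVertexMinus n S x → Walk n S x x
  step : ∀ {x y z} → IsVertexMinus n S x → Adj n x y → Walk n S y z → Walk n S x z

-- S is a separating set of G₂: S ⊆ V(G₂) and G₂ − S has more than one
-- connected component (two vertices not joined by any walk)
Separating : (n : ℕ) → .{{_ : Data.Nat.NonZero n}} → List ℕ → Set
Separating n S =
  (∀ {s} → s ∈ S → IsG₂Vertex n s) ×
  ∃[ u ] ∃[ v ] (IsVertexMinus n S u × IsVertexMinus n S v × ¬ Walk n S u v)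

-- κ(G₂) ≤ c : there is a separating set with at most c vertices
-- (S duplicate-free so that length S is its cardinality)
κ≤ : (n : ℕ) → .{{_ : Data.Nat.NonZero n}} → ℕ → Set
κ≤ n c = ∃[ S ] (Data.List.Relation.Unary.Unique.Propositional.Unique S × Separating n S × length S ≤ c)

-- Write n = Q P with P = p_m. A vertex y of G₂ comaximal with Q is coprime to Q, and being a
-- non-unit it must then be divisible by P; so y = k P with 0 < k < Q and k coprime to Q, and
-- there are exactly φ(Q) such vertices. Deleting them isolates Q, while Q·2 survives since
-- P ∤ 2Q.
module Submission where

open import Defs
open import Data.Nat using (ℕ; _<_; _≤_; _∸_; NonZero)
open import Data.Nat.Primality using (Prime)
open import Relation.Binary.PropositionalEquality using (_≡_)

open import Data.Nat using (zero; suc; _*_; _≟_; z≤n; s≤s; >-nonZero; ≢-nonZero⁻¹; nonTrivial⇒n>1)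
open import Data.Nat.Properties
open import Data.Nat.Divisibility
open import Data.Nat.GCD using (gcd; gcd[m,n]∣m; gcd[m,n]∣n; gcd-greatest)
open import Data.Nat.DivMod using (m<n⇒m%n≡m)
open import Data.Nat.Coprimality using (Coprime; coprime-divisor; coprime⇒gcd≡1; gcd≡1⇒coprime)
open import Data.Nat.Primality using (prime⇒irreducible; prime⇒nonZero; prime⇒nonTrivial; euclidsLemma)
open import Data.List using (List; length; map; filter; applyDownFrom)
open import Data.List.Properties using (length-map; filter-accept; filter-reject)
open import Data.List.Membership.Propositional using (_∈_)
open import Data.List.Membership.Propositional.Properties
  using (∈-map⁺; ∈-map⁻; ∈-filter⁺; ∈-filter⁻; ∈-applyDownFrom⁺; ∈-applyDownFrom⁻)
open import Data.List.Relation.Unary.Unique.Propositional using (Unique)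
import Data.List.Relation.Unary.Unique.Propositional.Properties as Unique
open import Data.Product using (_×_; _,_; ∃-syntax)
open import Data.Sum using (inj₁; inj₂; [_,_]′)
open import Function using (flip)
open import Relation.Nullary using (¬_; Dec; yes; no; contradiction)
open import Relation.Binary.PropositionalEquality using (_≢_; refl; sym; trans; cong; subst)

prime⇒2≤ : ∀ {p} → Prime p → 2 ≤ p
prime⇒2≤ {p} pr = nonTrivial⇒n>1 p {{prime⇒nonTrivial pr}}

gcd-idem : ∀ m → gcd m m ≡ m
gcd-idem m = ∣-antisym (gcd[m,n]∣m m m) (gcd-greatest ∣-refl ∣-refl)

common-divisor⇒gcd≢1 : ∀ {d x n} → 2 ≤ d → d ∣ x → d ∣ n → ¬ gcd x n ≡ 1
common-divisor⇒gcd≢1 2≤d d∣x d∣n gcd≡1 =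
  <⇒≢ 2≤d (sym (gcd≡1⇒coprime gcd≡1 (d∣x , d∣n)))

coprimeTo? : ∀ k j → Dec (gcd j k ≡ 1)
coprimeTo? k j = gcd j k ≟ 1

coprimesUpTo : ℕ → ℕ → List ℕ
coprimesUpTo k i = filter (coprimeTo? k) (applyDownFrom suc i)

length-coprimesUpTo : ∀ k i → length (coprimesUpTo k i) ≡ countCoprime k i
length-coprimesUpTo k zero = refl
length-coprimesUpTo k (suc i) with gcd (suc i) k ≟ 1
... | yes coprime = trans (cong length (filter-accept (coprimeTo? k) {x = suc i} {xs = applyDownFrom suc i} coprime))
                          (cong suc (length-coprimesUpTo k i))
... | no ¬coprime = trans (cong length (filter-reject (coprimeTo? k) {x = suc i} {xs = applyDownFrom suc i} ¬coprime))
                          (length-coprimesUpTo k i)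

∈-coprimesUpTo⁻ : ∀ {k i j} → j ∈ coprimesUpTo k i → 0 < j × j ≤ i × gcd j k ≡ 1
∈-coprimesUpTo⁻ {k} {i} j∈ with ∈-filter⁻ (coprimeTo? k) {xs = applyDownFrom suc i} j∈
... | j∈range , coprime with ∈-applyDownFrom⁻ suc j∈range
...   | _ , l<i , refl = s≤s z≤n , l<i , coprime

∈-coprimesUpTo⁺ : ∀ {k i j} → 0 < j → j ≤ i → gcd j k ≡ 1 → j ∈ coprimesUpTo k i
∈-coprimesUpTo⁺ {k} {j = suc l} _ l<i coprime =
  ∈-filter⁺ (coprimeTo? k) (∈-applyDownFrom⁺ suc l<i) coprime

coprimesUpTo-unique : ∀ k i → Unique (coprimesUpTo k i)
coprimesUpTo-unique k i =
  Unique.filter⁺ (coprimeTo? k)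
    (Unique.applyDownFrom⁺₁ suc i (λ j<l _ eq → <⇒≢ j<l (sym (suc-injective eq))))

-- 1 < n is needed because 1 % 1 ≡ 0.
comaximal⇒coprime : ∀ {n x y} .{{_ : NonZero n}} → 1 < n → x ∣ n → Comaximal n x y → Coprime x y
comaximal⇒coprime 1<n x∣n (a , b , ax+by≡1) (d∣x , d∣y) =
  ∣1⇒≡1 (subst (_ ∣_) (trans ax+by≡1 (m<n⇒m%n≡m 1<n))
    (%-presˡ-∣ (∣m∣n⇒∣m+n (∣n⇒∣m*n a d∣x) (∣n⇒∣m*n b d∣y)) (∣-trans d∣x x∣n)))

coprime∧gcd≢1⇒prime∣ : ∀ {p q y} → Prime p → Coprime q y → ¬ gcd y (q * p) ≡ 1 → p ∣ y
coprime∧gcd≢1⇒prime∣ {p} {q} {y} p-prime q⊥y gcd≢1 =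
  [ flip contradiction gcd≢1 , (λ g≡p → subst (_∣ y) g≡p g∣y) ]′ (prime⇒irreducible p-prime g∣p)
  where
  g∣y : gcd y (q * p) ∣ y
  g∣y = gcd[m,n]∣m y (q * p)
  g⊥q : Coprime (gcd y (q * p)) q
  g⊥q (d∣g , d∣q) = q⊥y (d∣q , ∣-trans d∣g g∣y)
  g∣p : gcd y (q * p) ∣ p
  g∣p = coprime-divisor g⊥q (gcd[m,n]∣n y (q * p))

walk-source : ∀ {n} .{{_ : NonZero n}} {S x z} → Walk n S x z → IsVertexMinus n S x
walk-source (stay x∈) = x∈
walk-source (step x∈ _ _) = x∈

walk-from-isolated : ∀ {n} .{{_ : NonZero n}} {S x z} →
  (∀ {y} → Adj n x y → ¬ IsVertexMinus n S y) → Walk n S x z → x ≡ z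
walk-from-isolated isolated (stay _) = refl
walk-from-isolated isolated (step _ x~y w) = contradiction (walk-source w) (isolated x~y)

module LastPrimeSeparator (Q P : ℕ) (2≤Q : 2 ≤ Q) (2<P : 2 < P) (P-prime : Prime P) (P∤Q : ¬ P ∣ Q)
  where

  instance
    Q≢0 : NonZero Q
    Q≢0 = >-nonZero (≤-trans (s≤s z≤n) 2≤Q)

    P≢0 : NonZero P
    P≢0 = prime⇒nonZero P-prime

    QP≢0 : NonZero (Q * P)
    QP≢0 = m*n≢0 Q P

  separator : List ℕ
  separator = map (_* P) (coprimesUpTo Q Q)

  length-separator : length separator ≡ φ Q
  length-separator = trans (length-map (_* P) (coprimesUpTo Q Q)) (length-coprimesUpTo Q Q)

  separator-unique : Unique separator
  separator-unique = Unique.map⁺ (λ {k} {l} → *-cancelʳ-≡ k l P) (coprimesUpTo-unique Q Q)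

  ∈-separator⁻ : ∀ {s} → s ∈ separator → ∃[ k ] s ≡ k * P × 0 < k × k < Q
  ∈-separator⁻ s∈ with ∈-map⁻ (_* P) s∈
  ... | k , k∈ , s≡kP with ∈-coprimesUpTo⁻ k∈
  ...   | 0<k , k≤Q , k⊥Q = k , s≡kP , 0<k , ≤∧≢⇒< k≤Q k≢Q
    where
    k≢Q : k ≢ Q
    k≢Q refl = <⇒≢ 2≤Q (sym (trans (sym (gcd-idem k)) k⊥Q))

  ∈-separator⇒P∣ : ∀ {s} → s ∈ separator → P ∣ s
  ∈-separator⇒P∣ s∈ with ∈-separator⁻ s∈
  ... | k , refl , _ = n∣m*n k

  separator-vertex : ∀ {s} → s ∈ separator → IsG₂Vertex (Q * P) s
  separator-vertex s∈ with ∈-separator⁻ s∈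
  ... | k , refl , 0<k , k<Q =
      *-monoˡ-< P k<Q
    , ≢-nonZero⁻¹ (k * P) {{m*n≢0 k P}}
    , common-divisor⇒gcd≢1 (prime⇒2≤ P-prime) (n∣m*n k) (n∣m*n Q)
    where
    instance
      k≢0 : NonZero k
      k≢0 = >-nonZero 0<k

  ∈-separator⁺ : ∀ {k} → 0 < k → k < Q → gcd k Q ≡ 1 → k * P ∈ separator
  ∈-separator⁺ 0<k k<Q k⊥Q = ∈-map⁺ (_* P) (∈-coprimesUpTo⁺ 0<k (<⇒≤ k<Q) k⊥Q)

  coprime-vertex∈separator : ∀ {y} → IsG₂Vertex (Q * P) y → Coprime Q y → y ∈ separator
  coprime-vertex∈separator (y<QP , y≢0 , gcd≢1) Q⊥y
    with coprime∧gcd≢1⇒prime∣ P-prime Q⊥y gcd≢1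
  ... | divides k refl = ∈-separator⁺ 0<k (*-cancelʳ-< P k Q y<QP) k⊥Q
    where
    0<k : 0 < k
    0<k = n≢0⇒n>0 (λ k≡0 → y≢0 (cong (_* P) k≡0))
    k⊥Q : gcd k Q ≡ 1
    k⊥Q = coprime⇒gcd≡1 {k} (λ (d∣k , d∣Q) → Q⊥y (d∣Q , ∣m⇒∣m*n P d∣k))

  neighbour-of-Q∈separator : ∀ {y} → IsG₂Vertex (Q * P) y → Comaximal (Q * P) Q y → y ∈ separator
  neighbour-of-Q∈separator y∈G₂ Q~y =
    coprime-vertex∈separator y∈G₂ (comaximal⇒coprime (≤-trans 2≤Q (m≤m*n Q P)) (m∣m*n P) Q~y)

  multiple-of-Q-survives : ∀ {j} → 0 < j → j < P → IsVertexMinus (Q * P) separator (Q * j)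
  multiple-of-Q-survives {j} 0<j j<P =
      ( *-monoʳ-< Q j<P
      , ≢-nonZero⁻¹ (Q * j) {{m*n≢0 Q j}}
      , common-divisor⇒gcd≢1 2≤Q (m∣m*n j) (m∣m*n P))
    , λ Qj∈ → P∤Qj (∈-separator⇒P∣ Qj∈)
    where
    instance
      j≢0 : NonZero j
      j≢0 = >-nonZero 0<j
    P∤Qj : ¬ P ∣ Q * j
    P∤Qj P∣Qj with euclidsLemma Q j P-prime P∣Qj
    ... | inj₁ P∣Q = P∤Q P∣Q
    ... | inj₂ P∣j = <⇒≱ j<P (∣⇒≤ P∣j)

  Q-isolated : ∀ {y} → Adj (Q * P) Q y → ¬ IsVertexMinus (Q * P) separator y
  Q-isolated (_ , Q~y) (y∈G₂ , y∉separator) = y∉separator (neighbour-of-Q∈separator y∈G₂ Q~y)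

  κ≤φ : κ≤ (Q * P) (φ Q)
  κ≤φ = separator
      , separator-unique
      , ( separator-vertex
        , Q , Q * 2
        , subst (IsVertexMinus (Q * P) separator) (*-identityʳ Q)
            (multiple-of-Q-survives (s≤s z≤n) (<-trans (s≤s (s≤s z≤n)) 2<P))
        , multiple-of-Q-survives (s≤s z≤n) 2<P
        , λ walk → <⇒≢ (m<m*n Q 2 ≤-refl) (walk-from-isolated Q-isolated walk))
      , ≤-reflexive length-separator

1≤prod : ∀ {f} m → (∀ i → i < m → 1 ≤ f i) → 1 ≤ prod m f
1≤prod zero    _   = ≤-refl
1≤prod (suc m) 1≤f = *-mono-≤ (1≤prod m (λ i i<m → 1≤f i (m<n⇒m<1+n i<m))) (1≤f m (n<1+n m))

2≤prod : ∀ {f} m → 0 < m → (∀ i → i < m → 2 ≤ f i) → 2 ≤ prod m f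
2≤prod (suc m) _ 2≤f =
  *-mono-≤ {1} (1≤prod m (λ i i<m → ≤-trans (s≤s z≤n) (2≤f i (m<n⇒m<1+n i<m)))) (2≤f m (n<1+n m))

prime∤prod : ∀ {P f} m → Prime P → (∀ i → i < m → Prime (f i)) → (∀ i → i < m → f i < P) →
  ¬ P ∣ prod m f
prime∤prod zero P-prime _ _ P∣1 = <⇒≢ (prime⇒2≤ P-prime) (sym (∣1⇒≡1 P∣1))
prime∤prod {P} {f} (suc m) P-prime f-prime f<P P∣prod
  with euclidsLemma (prod m f) (f m) P-prime P∣prod
... | inj₁ P∣prod′ = prime∤prod m P-prime (λ i i<m → f-prime i (m<n⇒m<1+n i<m))
                       (λ i i<m → f<P i (m<n⇒m<1+n i<m)) P∣prod′
... | inj₂ P∣fm = <⇒≱ (f<P m (n<1+n m)) (∣⇒≤ {{prime⇒nonZero (f-prime m (n<1+n m))}} P∣fm)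

theorem5p6 : (m : ℕ) → 2 ≤ m → (p : ℕ → ℕ) →
    (∀ i → i < m → Prime (p i)) →
    (∀ i j → i < j → j < m → p i < p j) →
    (n : ℕ) → .{{_ : NonZero n}} → n ≡ prod m p →
    κ≤ n (φ (prod (m ∸ 1) p))
theorem5p6 (suc m) (s≤s 0<m) p prime increasing n refl =
  LastPrimeSeparator.κ≤φ (prod m p) (p m) 2≤Q 2<P (prime m (n<1+n m)) P∤Q
  where
  earlier-prime : ∀ i → i < m → Prime (p i)
  earlier-prime i i<m = prime i (m<n⇒m<1+n i<m)
  2≤Q : 2 ≤ prod m p
  2≤Q = 2≤prod m 0<m (λ i i<m → prime⇒2≤ (earlier-prime i i<m))
  2<P : 2 < p m
  2<P = ≤-<-trans (prime⇒2≤ (prime 0 (s≤s z≤n))) (increasing 0 m 0<m (n<1+n m))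
  P∤Q : ¬ p m ∣ prod m p
  P∤Q = prime∤prod m (prime m (n<1+n m)) earlier-prime (λ i i<m → increasing i m i<m (n<1+n m))
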